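{- Let $G=(X,Y,E)$ be a complete bipartite graph and let $\sigma$ be an imbalance optimal ordering of $X\cup Y$. Let $y_1,\dots,y_{|Y|}$ be the vertices of $Y$ listed in the order in which they occur in $\sigma$, and let $\sigma'=\mathrm{shift}_R(\sigma)$ be the ordering obtained from $\sigma$ by moving the vertex $y_{\lceil |Y|/2\rceil+1}$ to the rightmost position while keeping the relative order of all other vertices unchanged. Then $I(\sigma,G)=I(\sigma',G)$.
   Context: All graphs are finite, simple, undirected and connected. An ordering of a finite set $V$ is a bijection $\sigma:V\to\{1,\dots,|V|\}$; $u<_\sigma v$ means $\sigma(u)<\sigma(v)$. For a graph $G=(V,E)$, $I(v,\sigma,G)=\big|\,|\{u\in N(v): u<_\sigma v\}|-|\{u\in N(v): u>_\sigma v\}|\,\big|$ and $I(\sigma,G)=\sum_{v\in V}I(v,\sigma,G)$. The imbalance of $G$ is $I(G)=\min_\sigma I(\sigma,G)$ over all orderings of $V$; $\sigma$ is imbalance optimal if $I(\sigma,G)=I(G)$. In terms of blocks: writing $\sigma=\sigma_{L_0}\sigma_{\{y_1\}}\sigma_{L_1}\cdots\sigma_{\{y_{|Y|}\}}\sigma_{L_{|Y|}}$ where $L_i$ is the set of vertices of $X$ strictly between $y_i$ and $y_{i+1}$ (with $L_0$ before $y_1$, $L_{|Y|}$ after $y_{|Y|}$), $\mathrm{shift}_R(\sigma)=\sigma_{L_0}\big(\prod_{i=1}^{\lceil|Y|/2\rceil}\sigma_{\{y_i\}}\sigma_{L_i}\big)\sigma_{L_{\lceil|Y|/2\rceil+1}}\big(\prod_{i=\lceil|Y|/2\rceil+2}^{|Y|}\sigma_{\{y_i\}}\sigma_{L_i}\big)\sigma_{\{y_{\lceil|Y|/2\rceil+1}\}}$,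 where juxtaposition denotes concatenation of orderings. -}

module Defs where

open import Data.Nat using (ℕ; zero; suc; _+_; _≤_; ∣_-_∣; ⌈_/2⌉)
open import Data.Bool using (Bool; true; false)
open import Data.Fin using (Fin)
open import Data.Fin.Properties renaming (_≟_ to _≟F_)
open import Data.Sum using (_⊎_; inj₁; inj₂)
open import Data.Sum.Properties using (≡-dec)
open import Data.Maybe using (Maybe; just; nothing)
open import Data.List using (List; []; _∷_; _++_; [_]; filter; _∷ʳ_)
open import Data.List.Membership.Propositional using (_∈_)
open import Data.List.Relation.Unary.Unique.Propositional using (Unique)
open import Data.Product using (_×_)
open import Relation.Nullary using (¬?)
open import Relation.Binary.PropositionalEquality using (_≡_)
open import Relation.Binary using (DecidableEquality)

-- An ordering of the vertex set is represented as a list in which every vertex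
-- occurs exactly once (position in the list = σ-value).

IsOrdering : {V : Set} → List V → Set
IsOrdering {V} σ = Unique σ × (∀ (v : V) → v ∈ σ)

nbrCount : {V : Set} → (V → V → Bool) → V → List V → ℕ
nbrCount adj v [] = 0
nbrCount adj v (u ∷ us) with adj v u
... | true  = suc (nbrCount adj v us)
... | false = nbrCount adj v us

imbalanceAux : {V : Set} → (V → V → Bool) → List V → List V → ℕ
imbalanceAux adj pre [] = 0
imbalanceAux adj pre (v ∷ post) =
  ∣ nbrCount adj v pre - nbrCount adj v post ∣ + imbalanceAux adj (pre ∷ʳ v) post

imbalance : {V : Set} → (V → V → Bool) → List V → ℕ
imbalance adj σ = imbalanceAux adj [] σ

IsImbalanceOptimal : {V : Set} → (V → V → Bool) → List V → Set
IsImbalanceOptimal {V} adj σ =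
  IsOrdering σ × (∀ (τ : List V) → IsOrdering τ → imbalance adj σ ≤ imbalance adj τ)

-- Complete bipartite graph K_{m,n}: X = Fin m (inj₁), Y = Fin n (inj₂)
Vtx : ℕ → ℕ → Set
Vtx m n = Fin m ⊎ Fin n

completeBipartite : (m n : ℕ) → Vtx m n → Vtx m n → Bool
completeBipartite m n (inj₁ _) (inj₁ _) = false
completeBipartite m n (inj₁ _) (inj₂ _) = true
completeBipartite m n (inj₂ _) (inj₁ _) = true
completeBipartite m n (inj₂ _) (inj₂ _) = false

_≟V_ : {m n : ℕ} → DecidableEquality (Vtx m n)
_≟V_ = ≡-dec _≟F_ _≟F_

yVertices : {m n : ℕ} → List (Vtx m n) → List (Fin n)
yVertices [] = []
yVertices (inj₁ _ ∷ σ) = yVertices σ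
yVertices (inj₂ y ∷ σ) = y ∷ yVertices σ

_!?_ : {A : Set} → List A → ℕ → Maybe A
[] !? _ = nothing
(x ∷ xs) !? zero = just x
(x ∷ xs) !? suc k = xs !? k

moveToEnd : {m n : ℕ} → Vtx m n → List (Vtx m n) → List (Vtx m n)
moveToEnd w σ = filter (λ u → ¬? (u ≟V w)) σ ++ [ w ]

-- shift_R(σ): move y_{⌈|Y|/2⌉+1} (1-based; index ⌈|Y|/2⌉ 0-based) to the end.
-- If that vertex does not exist (|Y| ≤ 1), shift_R is undefined; we return σ.
shiftR : {m n : ℕ} → List (Vtx m n) → List (Vtx m n)
shiftR {m} {n} σ with yVertices σ !? ⌈ n /2⌉
... | just y  = moveToEnd (inj₂ y) σ
... | nothing = σ

-- Write σ = α ++ w ∷ β where w = y_{⌈|Y|/2⌉+1}, so α contains ⌈|Y|/2⌉ vertices of Y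
-- and β fewer than that. Moving w behind β leaves every term of α and of the
-- Y-vertices unchanged; for each x ∈ X ∩ β the Y-vertices before x outnumber those
-- after x by at least 2, so its term drops by exactly 2. The term of w itself grows
-- from |a - b| to a + b (a, b the numbers of X-vertices in α and β), i.e. by at most
-- 2b. Hence shift_R does not increase the imbalance, and optimality of σ gives equality.
module Submission where

open import Defs
open import Data.Bool using (Bool; true; false)
open import Data.Nat using (ℕ; zero; suc; _+_; _≤_; _<_; ∣_-_∣; ⌈_/2⌉; ⌊_/2⌋; s≤s)
open import Data.Nat.Properties
open import Data.Nat.Tactic.RingSolver using (solve-∀)
open import Algebra.Properties.CommutativeSemigroup +-commutativeSemigroup using (x∙yz≈y∙xz)
open import Data.Fin as Fin using (Fin)
open import Data.Fin.Properties using (injective⇒≤)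
open import Data.List using (List; []; _∷_; _++_; [_]; _∷ʳ_; filter; length; lookup)
open import Data.List.Properties using (++-assoc; ++-identityʳ; length-++; filter-++; filter-all; filter-reject)
open import Data.List.Relation.Unary.All as All using (All; []; _∷_)
open import Data.List.Relation.Unary.AllPairs using ([]; _∷_)
open import Data.List.Relation.Unary.Unique.Propositional using (Unique)
import Data.List.Relation.Binary.Permutation.Setoid.Properties as Permutationₛ
open import Data.List.Membership.Propositional.Properties using (∈-lookup)
open import Data.List.Relation.Binary.Permutation.Propositional as ↭ using (_↭_; ↭-sym; ↭⇒↭ₛ)
open import Data.List.Relation.Binary.Permutation.Propositional.Properties using (∈-resp-↭; ++⁺ˡ; ++⁺ʳ; shift; ∷↭∷ʳ)
open import Data.Sum using (inj₁; inj₂)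
open import Data.Maybe using (just; nothing)
open import Data.Product using (_×_; _,_; proj₁; Σ-syntax)
open import Relation.Nullary using (¬?; contradiction)
open import Relation.Unary using (Decidable)
open import Relation.Binary.PropositionalEquality hiding ([_])

module _ {V : Set} (adj : V → V → Bool) where

  nbrCount-++ : ∀ v (A B : List V) → nbrCount adj v (A ++ B) ≡ nbrCount adj v A + nbrCount adj v B
  nbrCount-++ v [] B = refl
  nbrCount-++ v (u ∷ A) B with adj v u
  ... | true  = cong suc (nbrCount-++ v A B)
  ... | false = nbrCount-++ v A B

  nbrCount-↭ : ∀ v {A B : List V} → A ↭ B → nbrCount adj v A ≡ nbrCount adj v B
  nbrCount-↭ v ↭.refl = refl
  nbrCount-↭ v {u ∷ xs} {u ∷ ys} (↭.prep u p) = begin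
      c (u ∷ xs)     ≡⟨ nbrCount-++ v [ u ] xs ⟩
      c [ u ] + c xs ≡⟨ cong (c [ u ] +_) (nbrCount-↭ v p) ⟩
      c [ u ] + c ys ≡⟨ nbrCount-++ v [ u ] ys ⟨
      c (u ∷ ys)     ∎
    where
    open ≡-Reasoning
    c : List V → ℕ
    c = nbrCount adj v
  nbrCount-↭ v {u ∷ u′ ∷ xs} {u′ ∷ u ∷ ys} (↭.swap u u′ p) = begin
      c (u ∷ u′ ∷ xs)          ≡⟨ nbrCount-++ v [ u ] (u′ ∷ xs) ⟩
      c [ u ] + c (u′ ∷ xs)    ≡⟨ cong (c [ u ] +_) (nbrCount-++ v [ u′ ] xs) ⟩
      c [ u ] + (c [ u′ ] + c xs) ≡⟨ x∙yz≈y∙xz (c [ u ]) (c [ u′ ]) (c xs) ⟩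
      c [ u′ ] + (c [ u ] + c xs) ≡⟨ cong (λ k → c [ u′ ] + (c [ u ] + k)) (nbrCount-↭ v p) ⟩
      c [ u′ ] + (c [ u ] + c ys) ≡⟨ cong (c [ u′ ] +_) (nbrCount-++ v [ u ] ys) ⟨
      c [ u′ ] + c (u ∷ ys)    ≡⟨ nbrCount-++ v [ u′ ] (u ∷ ys) ⟨
      c (u′ ∷ u ∷ ys)          ∎
    where
    open ≡-Reasoning
    c : List V → ℕ
    c = nbrCount adj v
  nbrCount-↭ v (↭.trans p q) = trans (nbrCount-↭ v p) (nbrCount-↭ v q)

  -- The contribution to the imbalance of the vertices of L, in an ordering pre ++ L ++ post.
  blockImbalance : List V → List V → List V → ℕ
  blockImbalance pre [] post = 0
  blockImbalance pre (v ∷ L) post =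
    ∣ nbrCount adj v pre - nbrCount adj v (L ++ post) ∣ + blockImbalance (pre ∷ʳ v) L post

  imbalanceAux≡blockImbalance : ∀ pre L → imbalanceAux adj pre L ≡ blockImbalance pre L []
  imbalanceAux≡blockImbalance pre [] = refl
  imbalanceAux≡blockImbalance pre (v ∷ L) =
    cong₂ _+_ (cong (λ s → ∣ nbrCount adj v pre - nbrCount adj v s ∣) (sym (++-identityʳ L)))
              (imbalanceAux≡blockImbalance (pre ∷ʳ v) L)

  blockImbalance-++ : ∀ pre α L post →
    blockImbalance pre (α ++ L) post ≡ blockImbalance pre α (L ++ post) + blockImbalance (pre ++ α) L post
  blockImbalance-++ pre [] L post = cong (λ p → blockImbalance p L post) (sym (++-identityʳ pre))
  blockImbalance-++ pre (v ∷ α) L post = begin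
      ∣ c pre - c ((α ++ L) ++ post) ∣ + blockImbalance (pre ∷ʳ v) (α ++ L) post
    ≡⟨ cong₂ (λ s t → ∣ c pre - c s ∣ + t) (++-assoc α L post) (blockImbalance-++ (pre ∷ʳ v) α L post) ⟩
      ∣ c pre - c (α ++ L ++ post) ∣ + (blockImbalance (pre ∷ʳ v) α (L ++ post) + blockImbalance ((pre ∷ʳ v) ++ α) L post)
    ≡⟨ +-assoc ∣ c pre - c (α ++ L ++ post) ∣ _ _ ⟨
      blockImbalance pre (v ∷ α) (L ++ post) + blockImbalance ((pre ∷ʳ v) ++ α) L post
    ≡⟨ cong (λ p → blockImbalance pre (v ∷ α) (L ++ post) + blockImbalance p L post) (++-assoc pre [ v ] α) ⟩
      blockImbalance pre (v ∷ α) (L ++ post) + blockImbalance (pre ++ v ∷ α) L post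
    ∎ where
    open ≡-Reasoning
    c : List V → ℕ
    c = nbrCount adj v

  blockImbalance-↭ : ∀ {pre pre′ post post′} → pre ↭ pre′ → post ↭ post′ →
    ∀ L → blockImbalance pre L post ≡ blockImbalance pre′ L post′
  blockImbalance-↭ p q [] = refl
  blockImbalance-↭ p q (v ∷ L) =
    cong₂ _+_ (cong₂ ∣_-_∣ (nbrCount-↭ v p) (nbrCount-↭ v (++⁺ˡ L q)))
              (blockImbalance-↭ (++⁺ʳ [ v ] p) q L)

∣1+m-n∣≡2+∣m-1+n∣ : ∀ {m n} → n < m → ∣ suc m - n ∣ ≡ 2 + ∣ m - suc n ∣
∣1+m-n∣≡2+∣m-1+n∣ {suc m} {zero}  _         = cong (2 +_) (sym (∣-∣-identityʳ m))
∣1+m-n∣≡2+∣m-1+n∣ {suc m} {suc n} (s≤s n<m) = ∣1+m-n∣≡2+∣m-1+n∣ n<m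

m+n≤∣m-n∣+[n+n] : ∀ m n → m + n ≤ ∣ m - n ∣ + (n + n)
m+n≤∣m-n∣+[n+n] m n = ≤-trans (+-monoˡ-≤ n (m≤∣m-n∣+n m n)) (≤-reflexive (+-assoc ∣ m - n ∣ n n))

⌈n/2⌉+1+k≤n⇒k<⌈n/2⌉ : ∀ n k → ⌈ n /2⌉ + suc k ≤ n → k < ⌈ n /2⌉
⌈n/2⌉+1+k≤n⇒k<⌈n/2⌉ n k h = ≤-trans 1+k≤⌊n/2⌋ (⌊n/2⌋≤⌈n/2⌉ n)
  where
  1+k≤⌊n/2⌋ : suc k ≤ ⌊ n /2⌋
  1+k≤⌊n/2⌋ = +-cancelˡ-≤ ⌈ n /2⌉ (suc k) ⌊ n /2⌋
    (≤-trans h (≤-reflexive (trans (sym (⌊n/2⌋+⌈n/2⌉≡n n)) (+-comm ⌊ n /2⌋ ⌈ n /2⌉))))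

module _ {A : Set} where

  lookup-injective : {xs : List A} → Unique xs → ∀ i j → lookup xs i ≡ lookup xs j → i ≡ j
  lookup-injective (_ ∷ _)    Fin.zero    Fin.zero    _ = refl
  lookup-injective (x∉xs ∷ _) Fin.zero    (Fin.suc j) e = contradiction e (All.lookup x∉xs (∈-lookup j))
  lookup-injective (x∉xs ∷ _) (Fin.suc i) Fin.zero    e = contradiction (sym e) (All.lookup x∉xs (∈-lookup i))
  lookup-injective (_ ∷ u)    (Fin.suc i) (Fin.suc j) e = cong Fin.suc (lookup-injective u i j e)

  Unique-resp-↭ : {xs ys : List A} → xs ↭ ys → Unique xs → Unique ys
  Unique-resp-↭ p = Permutationₛ.Unique-resp-↭ (setoid A) (↭⇒↭ₛ p)

  IsOrdering-resp-↭ : {xs ys : List A} → xs ↭ ys → IsOrdering xs → IsOrdering ys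
  IsOrdering-resp-↭ p (u , complete) = Unique-resp-↭ p u , λ v → ∈-resp-↭ p (complete v)

Unique⇒length≤ : ∀ {n} {ys : List (Fin n)} → Unique ys → length ys ≤ n
Unique⇒length≤ u = injective⇒≤ (λ {i} {j} → lookup-injective u i j)

moveToEnd-middle : ∀ {m n} (α β : List (Vtx m n)) w →
  Unique (α ++ w ∷ β) → moveToEnd w (α ++ w ∷ β) ≡ α ++ β ++ [ w ]
moveToEnd-middle α β w u = begin
    filter P? (α ++ w ∷ β) ++ [ w ]
  ≡⟨ cong (_++ [ w ]) (filter-++ P? α (w ∷ β)) ⟩
    (filter P? α ++ filter P? (w ∷ β)) ++ [ w ]
  ≡⟨ cong (λ l → (filter P? α ++ l) ++ [ w ]) (filter-reject P? (λ w≢w → w≢w refl)) ⟩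
    (filter P? α ++ filter P? β) ++ [ w ]
  ≡⟨ cong (_++ [ w ]) (filter-++ P? α β) ⟨
    filter P? (α ++ β) ++ [ w ]
  ≡⟨ cong (_++ [ w ]) (filter-all P? (All.map ≢-sym w∉α++β)) ⟩
    (α ++ β) ++ [ w ]
  ≡⟨ ++-assoc α β [ w ] ⟩
    α ++ β ++ [ w ]
  ∎ where
  open ≡-Reasoning
  P? : Decidable (_≢ w)
  P? v = ¬? (v ≟V w)
  w∉α++β : All (w ≢_) (α ++ β)
  w∉α++β with Unique-resp-↭ (shift w α β) u
  ... | w∉ ∷ _ = w∉

module _ {m n : ℕ} where

  private
    V = Vtx m n
    cb = completeBipartite m n

  countY : List V → ℕ
  countY L = length (yVertices L)

  yVertices-++ : ∀ (A B : List V) → yVertices (A ++ B) ≡ yVertices A ++ yVertices B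
  yVertices-++ []           B = refl
  yVertices-++ (inj₁ _ ∷ A) B = yVertices-++ A B
  yVertices-++ (inj₂ y ∷ A) B = cong (y ∷_) (yVertices-++ A B)

  countY-++ : ∀ (A B : List V) → countY (A ++ B) ≡ countY A + countY B
  countY-++ A B = trans (cong length (yVertices-++ A B)) (length-++ (yVertices A))

  countY-∷-< : ∀ v L P → countY (v ∷ L) < countY P → countY L < countY (P ∷ʳ v)
  countY-∷-< v L P lt = ≤-trans (≤-trans (s≤s (L≤v∷L v)) lt)
                                (≤-trans (m≤m+n (countY P) (countY [ v ])) (≤-reflexive (sym (countY-++ P [ v ]))))
    where
    L≤v∷L : ∀ v → countY L ≤ countY (v ∷ L)
    L≤v∷L (inj₁ _) = ≤-refl
    L≤v∷L (inj₂ _) = n≤1+n (countY L)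

  nbrCount-inj₁ : ∀ x (L : List V) → nbrCount cb (inj₁ x) L ≡ countY L
  nbrCount-inj₁ x []           = refl
  nbrCount-inj₁ x (inj₁ _ ∷ L) = nbrCount-inj₁ x L
  nbrCount-inj₁ x (inj₂ _ ∷ L) = cong suc (nbrCount-inj₁ x L)

  Unique-yVertices : {σ : List V} → Unique σ → Unique (yVertices σ)
  Unique-yVertices {[]}         _        = []
  Unique-yVertices {inj₁ _ ∷ σ} (_ ∷ u) = Unique-yVertices u
  Unique-yVertices {inj₂ _ ∷ σ} (v∉σ ∷ u) = ∉-yVertices v∉σ ∷ Unique-yVertices u
    where
    ∉-yVertices : ∀ {y σ} → All (inj₂ y ≢_) σ → All (y ≢_) (yVertices σ)
    ∉-yVertices {σ = []}         []        = []
    ∉-yVertices {σ = inj₁ _ ∷ σ} (_ ∷ ps)  = ∉-yVertices ps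
    ∉-yVertices {σ = inj₂ _ ∷ σ} (p ∷ ps)  = (λ e → p (cong inj₂ e)) ∷ ∉-yVertices ps

  yVertices-!?-split : ∀ (σ : List V) k {y} → yVertices σ !? k ≡ just y →
    Σ[ α ∈ List V ] Σ[ β ∈ List V ] σ ≡ α ++ inj₂ y ∷ β × countY α ≡ k
  yVertices-!?-split (inj₁ x ∷ σ) k e with yVertices-!?-split σ k e
  ... | α , β , refl , |α| = inj₁ x ∷ α , β , refl , |α|
  yVertices-!?-split (inj₂ _ ∷ σ) zero    refl = [] , σ , refl , refl
  yVertices-!?-split (inj₂ y ∷ σ) (suc k) e with yVertices-!?-split σ k e
  ... | α , β , refl , |α| = inj₂ y ∷ α , β , refl , cong suc |α|

  countY-after-⌈n/2⌉ : ∀ α y β → Unique (α ++ inj₂ y ∷ β) → countY α ≡ ⌈ n /2⌉ →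
    countY β < countY α
  countY-after-⌈n/2⌉ α y β u |α| =
    subst (countY β <_) (sym |α|) (⌈n/2⌉+1+k≤n⇒k<⌈n/2⌉ n (countY β) (begin
      ⌈ n /2⌉ + countY (inj₂ y ∷ β) ≡⟨ cong (_+ countY (inj₂ y ∷ β)) |α| ⟨
      countY α + countY (inj₂ y ∷ β) ≡⟨ countY-++ α (inj₂ y ∷ β) ⟨
      countY (α ++ inj₂ y ∷ β)       ≤⟨ Unique⇒length≤ (Unique-yVertices u) ⟩
      n                              ∎))
    where open ≤-Reasoning

  blockImbalance-moveY : ∀ y pre β post → countY (β ++ post) < countY pre →
      blockImbalance cb (pre ∷ʳ inj₂ y) β post
    ≡ blockImbalance cb pre β (inj₂ y ∷ post) + (nbrCount cb (inj₂ y) β + nbrCount cb (inj₂ y) β)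
  blockImbalance-moveY y pre []      post _  = refl
  blockImbalance-moveY y pre (v ∷ β) post lt = begin
      ∣ c (pre ∷ʳ w) - c (β ++ post) ∣ + B ((pre ∷ʳ w) ∷ʳ v) β post
    ≡⟨ cong₂ (λ a t → ∣ a - c (β ++ post) ∣ + t)
             (nbrCount-↭ cb v (↭-sym (∷↭∷ʳ w pre)))
             (blockImbalance-↭ cb w-v↭v-w ↭.refl β) ⟩
      ∣ c (w ∷ pre) - c (β ++ post) ∣ + B ((pre ∷ʳ v) ∷ʳ w) β post
    ≡⟨ cong (∣ c (w ∷ pre) - c (β ++ post) ∣ +_)
            (blockImbalance-moveY y (pre ∷ʳ v) β post (countY-∷-< v (β ++ post) pre lt)) ⟩
      ∣ c (w ∷ pre) - c (β ++ post) ∣ + (B′ + (h + h))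
    ≡⟨ vertex-step v lt ⟩
      ∣ c pre - c (w ∷ β ++ post) ∣ + B′ + (hᵥ + hᵥ)
    ≡⟨ cong (λ b → ∣ c pre - b ∣ + B′ + (hᵥ + hᵥ)) (nbrCount-↭ cb v (shift w β post)) ⟨
      ∣ c pre - c (β ++ w ∷ post) ∣ + B′ + (hᵥ + hᵥ)
    ∎ where
    open ≡-Reasoning
    w : V
    w = inj₂ y
    B : List V → List V → List V → ℕ
    B = blockImbalance cb
    c : List V → ℕ
    c = nbrCount cb v
    B′ h hᵥ : ℕ
    B′ = B (pre ∷ʳ v) β (w ∷ post)
    h = nbrCount cb w β
    hᵥ = nbrCount cb w (v ∷ β)
    w-v↭v-w : (pre ∷ʳ w) ∷ʳ v ↭ (pre ∷ʳ v) ∷ʳ w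
    w-v↭v-w = subst₂ _↭_ (sym (++-assoc pre [ w ] [ v ])) (sym (++-assoc pre [ v ] [ w ]))
                       (++⁺ˡ pre (↭.swap w v ↭.refl))
    vertex-step : ∀ v {b} → countY (v ∷ β ++ post) < countY pre →
        ∣ nbrCount cb v (w ∷ pre) - nbrCount cb v (β ++ post) ∣ + (b + (h + h))
      ≡ ∣ nbrCount cb v pre - nbrCount cb v (w ∷ β ++ post) ∣ + b
        + (nbrCount cb w (v ∷ β) + nbrCount cb w (v ∷ β))
    vertex-step (inj₁ x) {b} lt = begin
        ∣ suc (nbrCount cb (inj₁ x) pre) - nbrCount cb (inj₁ x) (β ++ post) ∣ + (b + (h + h))
      ≡⟨ cong (_+ (b + (h + h))) (∣1+m-n∣≡2+∣m-1+n∣ (subst₂ _<_ (sym (nbrCount-inj₁ x (β ++ post)))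
                                                                (sym (nbrCount-inj₁ x pre)) lt)) ⟩
        2 + ∣ nbrCount cb (inj₁ x) pre - suc (nbrCount cb (inj₁ x) (β ++ post)) ∣ + (b + (h + h))
      ≡⟨ regroup _ b h ⟩
        ∣ nbrCount cb (inj₁ x) pre - suc (nbrCount cb (inj₁ x) (β ++ post)) ∣ + b + (suc h + suc h)
      ∎ where
      regroup : ∀ d b h → 2 + d + (b + (h + h)) ≡ d + b + (suc h + suc h)
      regroup = solve-∀
    vertex-step (inj₂ y′) {b} _ =
      sym (+-assoc ∣ nbrCount cb (inj₂ y′) pre - nbrCount cb (inj₂ y′) (β ++ post) ∣ b (h + h))

  imbalance-moveY-≤ : ∀ y α β → countY β < countY α →
    imbalance cb (α ++ β ++ [ inj₂ y ]) ≤ imbalance cb (α ++ inj₂ y ∷ β)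
  imbalance-moveY-≤ y α β lt = begin
      imbalance cb (α ++ β ++ [ w ])
    ≡⟨ imbalanceAux≡blockImbalance cb [] (α ++ β ++ [ w ]) ⟩
      B [] (α ++ β ++ [ w ]) []
    ≡⟨ blockImbalance-++ cb [] α (β ++ [ w ]) [] ⟩
      B [] α ((β ++ [ w ]) ++ []) + B α (β ++ [ w ]) []
    ≡⟨ cong₂ _+_ (blockImbalance-↭ cb ↭.refl (++⁺ʳ [] (↭-sym (∷↭∷ʳ w β))) α)
                 (blockImbalance-++ cb α β [ w ] []) ⟩
      P + (M + (∣ c (α ++ β) - 0 ∣ + 0))
    ≡⟨ cong (λ k → P + (M + k)) (trans (+-identityʳ _) (trans (∣-∣-identityʳ _) (nbrCount-++ cb w α β))) ⟩
      P + (M + (a + b))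
    ≤⟨ +-monoʳ-≤ P (+-monoʳ-≤ M (m+n≤∣m-n∣+[n+n] a b)) ⟩
      P + (M + (∣ a - b ∣ + (b + b)))
    ≡⟨ cong (P +_) (x∙yz≈y∙xz M ∣ a - b ∣ (b + b)) ⟩
      P + (∣ a - b ∣ + (M + (b + b)))
    ≡⟨ cong (λ k → P + (∣ a - c k ∣ + (M + (b + b)))) (++-identityʳ β) ⟨
      P + (∣ a - c (β ++ []) ∣ + (M + (b + b)))
    ≡⟨ cong (λ k → P + (∣ a - c (β ++ []) ∣ + k))
            (blockImbalance-moveY y α β [] (subst (λ k → countY k < countY α) (sym (++-identityʳ β)) lt)) ⟨
      P + B α (w ∷ β) []
    ≡⟨ blockImbalance-++ cb [] α (w ∷ β) [] ⟨
      B [] (α ++ w ∷ β) []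
    ≡⟨ imbalanceAux≡blockImbalance cb [] (α ++ w ∷ β) ⟨
      imbalance cb (α ++ w ∷ β)
    ∎ where
    open ≤-Reasoning
    w : V
    w = inj₂ y
    B : List V → List V → List V → ℕ
    B = blockImbalance cb
    c : List V → ℕ
    c = nbrCount cb w
    P M a b : ℕ
    P = B [] α ((w ∷ β) ++ [])
    M = B α β [ w ]
    a = c α
    b = c β

lemma3 : (m n : ℕ) → 1 ≤ m → 2 ≤ n → (σ : List (Vtx m n))
    → IsImbalanceOptimal (completeBipartite m n) σ
    → imbalance (completeBipartite m n) σ
    ≡ imbalance (completeBipartite m n) (shiftR σ)
lemma3 m n _ _ σ (ordering , optimal) with yVertices σ !? ⌈ n /2⌉ in eq
... | nothing = refl
... | just y with yVertices-!?-split σ ⌈ n /2⌉ eq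
... | α , β , refl , |α| = ≤-antisym (optimal _ shifted-ordering) shifted-≤
  where
  G : Vtx m n → Vtx m n → Bool
  G = completeBipartite m n
  w : Vtx m n
  w = inj₂ y
  moved : moveToEnd w (α ++ w ∷ β) ≡ α ++ β ++ [ w ]
  moved = moveToEnd-middle α β w (proj₁ ordering)
  shifted-ordering : IsOrdering (moveToEnd w (α ++ w ∷ β))
  shifted-ordering = subst IsOrdering (sym moved) (IsOrdering-resp-↭ (++⁺ˡ α (∷↭∷ʳ w β)) ordering)
  shifted-≤ : imbalance G (moveToEnd w (α ++ w ∷ β)) ≤ imbalance G (α ++ w ∷ β)
  shifted-≤ = ≤-trans (≤-reflexive (cong (imbalance G) moved))
                (imbalance-moveY-≤ y α β (countY-after-⌈n/2⌉ α y β (proj₁ ordering) |α|))
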